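{- Let $F$ be a field and $u\in\mathbb{N}$. Let $m,n,r\in\mathbb{N}$ satisfy $m+n\leq u$, $r\leq m$ and $r\leq n$. Let $s=m+n-r$. Let $x\in F^{u+1}$ be arbitrary. Then $\operatorname{rank}(H_{m,n}(x))\leq r$ if and only if $\operatorname{rank}(H_{r,s}(x))\leq r$.
   Context: $\mathbb{N}=\{0,1,2,\ldots\}$. For $x=(x_0,x_1,\ldots,x_u)\in F^{u+1}$ and integers $p,t\in\{ -1,0,1,\ldots\}$ with $p+t\leq u$, $H_{p,t}(x)$ is the $(p+1)\times(t+1)$ matrix $(x_{i+j})_{0\leq i\leq p,\ 0\leq j\leq t}$. -}

module Defs where

open import Level using (Level; _⊔_) renaming (suc to lsuc)
open import Algebra.Bundles using (CommutativeRing)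
open import Data.Nat using (ℕ; zero; suc; _+_; _∸_; _≤_; _<_; s≤s)
open import Data.Nat.Properties using (m+[n∸m]≡n; ≤-trans; m≤m+n; +-mono-≤)
open import Data.Fin using (Fin; toℕ; fromℕ<)
import Data.Fin as Fin
open import Data.Fin.Properties using (toℕ≤pred[n])
open import Data.Product using (Σ; ∃; _×_)
open import Function.Definitions using (Injective)
open import Relation.Nullary using (¬_)
open import Relation.Binary.PropositionalEquality using (_≡_; subst; sym)

record Field (c ℓ : Level) : Set (lsuc (c ⊔ ℓ)) where
  field
    commutativeRing : CommutativeRing c ℓ
  open CommutativeRing commutativeRing public
  field
    0≉1     : ¬ (0# ≈ 1#)
    inverse : ∀ x → ¬ (x ≈ 0#) → Σ Carrier (λ y → (x * y) ≈ 1#)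

Matrix : ∀ {a} → Set a → ℕ → ℕ → Set a
Matrix A k l = Fin k → Fin l → A

hankel-bound : ∀ {p t u} → p + t ≤ u → (i : Fin (suc p)) (j : Fin (suc t)) →
               toℕ i + toℕ j < suc u
hankel-bound pt≤u i j = s≤s (≤-trans (+-mono-≤ (toℕ≤pred[n] i) (toℕ≤pred[n] j)) pt≤u)

H : ∀ {a} {A : Set a} {u} (p t : ℕ) → p + t ≤ u → (Fin (suc u) → A) →
    Matrix A (suc p) (suc t)
H p t pt≤u x i j = x (fromℕ< (hankel-bound pt≤u i j))

module _ {c ℓ} (F : Field c ℓ) where
  open Field F using (Carrier; _≈_; 0#) renaming (_+_ to _+F_; _*_ to _*F_)

  sumF : ∀ {k} → (Fin k → Carrier) → Carrier
  sumF {zero}  f = 0#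
  sumF {suc k} f = f Fin.zero +F sumF (λ i → f (Fin.suc i))

  LinearlyIndependent : ∀ {rows k} → (Fin k → Fin rows → Carrier) → Set (c ⊔ ℓ)
  LinearlyIndependent {rows} {k} v =
    ∀ (coef : Fin k → Carrier) →
      (∀ (a : Fin rows) → sumF (λ j → coef j *F v j a) ≈ 0#) →
      ∀ j → coef j ≈ 0#

  -- rank M ≤ r : the rank of M (= maximal number of linearly independent
  -- columns) is at most r, i.e. no r+1 distinct columns are linearly independent.
  RankAtMost : ∀ {k l} → ℕ → Matrix Carrier k l → Set (c ⊔ ℓ)
  RankAtMost {k} {l} r M =
    ∀ (f : Fin (suc r) → Fin l) → Injective _≡_ _≡_ f →
      ¬ LinearlyIndependent (λ j a → M a (f j))

rs-bound : ∀ {m n r u} → m + n ≤ u → r ≤ m → r + (m + n ∸ r) ≤ u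
rs-bound {m} {n} {r} {u} mn≤u r≤m =
  subst (_≤ u) (sym (m+[n∸m]≡n (≤-trans r≤m (m≤m+n m n)))) mn≤u

{-# OPTIONS --safe #-}

-- Extend x by zeros to a sequence y, so that H_{p,t} has the columns
-- (y_{i+j})_{i≤p}, j ≤ t.  The heart of the proof is the step
--   rank H_{p+1,t} ≤ r ≤ t  ⇒  rank H_{p,t+1} ≤ r.
-- Run Gaussian elimination along the columns of H_{p+1,t}: at most r ≤ t of its t+1
-- columns are pivots, so some column depends on the earlier ones.  Deleting the last
-- row of such a dependency gives one for the same columns of H_{p,·}, deleting the first
-- row gives one for the columns shifted by one; hence from the first dependent column on,
-- all columns of H_{p,t+1} stay in a space with one generator per pivot.  The converse
-- step follows by transposition (row rank ≤ column rank, by the Steinitz exchange lemma),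
-- and applying the two steps m - r times moves H_{m,n} to H_{r,s}.
-- Equality in F is not decidable, so case distinctions are made under double negation;
-- this suffices because RankAtMost is a negation.
module Submission where

open import Defs
open import Level using (Level; _⊔_)
open import Data.Fin as Fin using (Fin; zero; suc; toℕ; fromℕ<; punchIn; inject₁; inject≤)
import Data.Fin.Properties as Finₚ
open import Data.Nat as ℕ using (ℕ; zero; suc; _≤_; _<_; s≤s)
import Data.Nat.Properties as ℕₚ
open import Data.Empty using (⊥)
open import Data.Product using (Σ; ∃; _×_; _,_; proj₁; proj₂)
open import Data.Sum using (_⊎_; inj₁; inj₂; [_,_])
open import Data.Vec.Functional using (Vector; insertAt)
open import Effect.Monad using (RawMonad)
open import Function using (_∘_; _⇔_; mk⇔)
open import Function.Properties.Equivalence using (⇔-setoid)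
  renaming (refl to ⇔-refl; sym to ⇔-sym; trans to ⇔-trans)
open import Function.Definitions using (Injective)
open import Relation.Nullary using (¬_; yes; no)
open import Relation.Nullary.Decidable using (¬¬-excluded-middle)
open import Relation.Nullary.Negation using (¬¬-Monad; contradiction)
open import Relation.Binary.PropositionalEquality as ≡ using (_≡_; _≢_)

¬¬-pull-Fin : ∀ {p k} {P : Fin k → Set p} → (∀ i → ¬ ¬ P i) → ¬ ¬ (∀ i → P i)
¬¬-pull-Fin {k = zero}  h ¬∀ = ¬∀ (λ ())
¬¬-pull-Fin {k = suc k} h ¬∀ =
  h zero λ p₀ → ¬¬-pull-Fin (h ∘ suc) λ ps → ¬∀ λ { zero → p₀ ; (suc i) → ps i }

insertAt-same : ∀ {a} {A : Set a} {n} (xs : Vector A n) i x → insertAt xs i x i ≡ x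
insertAt-same {n = _}     xs zero    x = ≡.refl
insertAt-same {n = suc _} xs (suc i) x = insertAt-same (xs ∘ suc) i x

insertAt-punchIn : ∀ {a} {A : Set a} {n} (xs : Vector A n) i x j → insertAt xs i x (punchIn i j) ≡ xs j
insertAt-punchIn {n = _}     xs zero    x j       = ≡.refl
insertAt-punchIn {n = suc _} xs (suc i) x zero    = ≡.refl
insertAt-punchIn {n = suc _} xs (suc i) x (suc j) = insertAt-punchIn (xs ∘ suc) i x j

extend : ∀ {a} {A : Set a} {n} → A → Vector A n → ℕ → A
extend {n = n} d v j with j ℕ.<? n
... | yes j<n = v (fromℕ< j<n)
... | no  _   = d

extend-fromℕ< : ∀ {a} {A : Set a} {n} (d : A) (v : Vector A n) {j} (j<n : j < n) →
                extend d v j ≡ v (fromℕ< j<n)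
extend-fromℕ< {n = n} d v {j} j<n with j ℕ.<? n
... | yes _    = ≡.refl
... | no  j≮n  = contradiction j<n j≮n

extend-toℕ : ∀ {a} {A : Set a} {n} (d : A) (v : Vector A n) i → extend d v (toℕ i) ≡ v i
extend-toℕ d v i = ≡.trans (extend-fromℕ< d v (Finₚ.toℕ<n i)) (≡.cong v (Finₚ.fromℕ<-toℕ i _))

module LinearAlgebra {c ℓ} (F : Field c ℓ) where
  open Field F hiding (zero)
    renaming (refl to ≈-refl; sym to ≈-sym; trans to ≈-trans; reflexive to ≈-reflexive)
  open import Algebra.Properties.Semiring.Sum semiring
  open import Algebra.Properties.Ring ring using (-‿distribˡ-*; -1*x≈-x)
  open import Algebra.Properties.Group +-group using (x∙y⁻¹≈ε⇒x≈y)
  open import Algebra.Solver.Ring.NaturalCoefficients.Default commutativeSemiring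
    using (solve; _:=_; _:+_; _:*_)
  open import Relation.Binary.Reasoning.Setoid setoid
  open RawMonad (¬¬-Monad {a = c ⊔ ℓ})

  Vec : ℕ → Set c
  Vec = Vector Carrier

  linComb : ∀ {q n} → Vec q → (Fin q → Vec n) → Vec n
  linComb co w a = sum (λ i → co i * w i a)

  infix 4 _∈Span_
  _∈Span_ : ∀ {q n} → Vec n → (Fin q → Vec n) → Set (c ⊔ ℓ)
  v ∈Span w = ∃ λ co → ∀ a → v a ≈ linComb co w a

  dot : ∀ {n} → Vec n → Vec n → Carrier
  dot φ v = sum (λ a → φ a * v a)

  unit : ∀ {n} → Fin n → Vec n
  unit zero    zero    = 1#
  unit zero    (suc _) = 0#
  unit (suc i) zero    = 0#
  unit (suc i) (suc j) = unit i j

  sumF≡sum : ∀ {k} (f : Vec k) → sumF F f ≡ sum f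
  sumF≡sum {zero}  f = ≡.refl
  sumF≡sum {suc k} f = ≡.cong (f zero +_) (sumF≡sum (f ∘ suc))

  sum-zero : ∀ {k} {f : Vec k} → (∀ i → f i ≈ 0#) → sum f ≈ 0#
  sum-zero {k} f≈0 = ≈-trans (sum-cong-≋ f≈0) (sum-replicate-zero k)

  sum-single : ∀ {k} (f : Vec k) i → (∀ j → j ≢ i → f j ≈ 0#) → sum f ≈ f i
  sum-single {suc k} f i f≈0 = begin
    sum f                          ≈⟨ sum-remove {i = i} f ⟩
    f i + sum (f ∘ punchIn i)      ≈⟨ +-congˡ (sum-zero (λ j → f≈0 _ (Finₚ.punchInᵢ≢i i j))) ⟩
    f i + 0#                       ≈⟨ +-identityʳ _ ⟩
    f i                            ∎

  sum-unit : ∀ {k} i (f : Vec k) → sum (λ j → unit i j * f j) ≈ f i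
  sum-unit zero    f = begin
    1# * f zero + sum (λ j → 0# * f (suc j))
      ≈⟨ +-cong (*-identityˡ _) (sum-zero (λ j → zeroˡ (f (suc j)))) ⟩
    f zero + 0#
      ≈⟨ +-identityʳ _ ⟩
    f zero ∎
  sum-unit (suc i) f = begin
    0# * f zero + sum (λ j → unit i j * f (suc j))  ≈⟨ +-cong (zeroˡ _) (sum-unit i (f ∘ suc)) ⟩
    0# + f (suc i)                                  ≈⟨ +-identityˡ _ ⟩
    f (suc i)                                       ∎

  sum-axpy : ∀ {k} (a b x : Vec k) m →
             sum (λ i → (a i + m * b i) * x i) ≈ sum (λ i → a i * x i) + m * sum (λ i → b i * x i)
  sum-axpy a b x m = begin
    sum (λ i → (a i + m * b i) * x i)
      ≈⟨ sum-cong-≋ (λ i → solve 4 (λ a b x m → (a :+ m :* b) :* x := a :* x :+ m :* (b :* x))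
                                   ≈-refl (a i) (b i) (x i) m) ⟩
    sum (λ i → a i * x i + m * (b i * x i))
      ≈⟨ ∑-distrib-+ (λ i → a i * x i) (λ i → m * (b i * x i)) ⟩
    sum (λ i → a i * x i) + sum (λ i → m * (b i * x i))
      ≈⟨ +-congˡ (≈-sym (*-distribˡ-sum m (λ i → b i * x i))) ⟩
    sum (λ i → a i * x i) + m * sum (λ i → b i * x i) ∎

  linComb-axpy : ∀ {q n} (a b : Vec q) m (w : Fin q → Vec n) x →
                 linComb (λ i → a i + m * b i) w x ≈ linComb a w x + m * linComb b w x
  linComb-axpy a b m w x = sum-axpy a b (λ i → w i x) m

  dot-axpyˡ : ∀ {n} (f h x : Vec n) m → dot (λ b → f b + m * h b) x ≈ dot f x + m * dot h x
  dot-axpyˡ f h x m = sum-axpy f h x m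

  dot-comm : ∀ {n} (φ v : Vec n) → dot φ v ≈ dot v φ
  dot-comm φ v = sum-cong-≋ (λ a → *-comm (φ a) (v a))

  dot-linCombˡ : ∀ {q n} (μ : Vec q) (φ : Fin q → Vec n) x →
                 dot (linComb μ φ) x ≈ sum (λ i → μ i * dot (φ i) x)
  dot-linCombˡ μ φ x = begin
    sum (λ b → sum (λ i → μ i * φ i b) * x b)
      ≈⟨ sum-cong-≋ (λ b → *-distribʳ-sum (x b) (λ i → μ i * φ i b)) ⟩
    sum (λ b → sum (λ i → μ i * φ i b * x b))
      ≈⟨ ∑-comm (λ b i → μ i * φ i b * x b) ⟩
    sum (λ i → sum (λ b → μ i * φ i b * x b))
      ≈⟨ sum-cong-≋ (λ i → ≈-trans (sum-cong-≋ (λ b → *-assoc (μ i) (φ i b) (x b)))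
                                   (≈-sym (*-distribˡ-sum (μ i) (λ b → φ i b * x b)))) ⟩
    sum (λ i → μ i * dot (φ i) x) ∎

  dot-linCombʳ : ∀ {q n} (φ : Vec n) (co : Vec q) (w : Fin q → Vec n) →
                 dot φ (linComb co w) ≈ sum (λ i → co i * dot φ (w i))
  dot-linCombʳ φ co w = ≈-trans (dot-comm φ (linComb co w))
    (≈-trans (dot-linCombˡ co w φ) (sum-cong-≋ (λ i → *-congˡ (dot-comm (w i) φ))))

  ∈Span-resp : ∀ {q n} {v v′ : Vec n} {w w′ : Fin q → Vec n} →
               (∀ a → v a ≈ v′ a) → (∀ i a → w i a ≈ w′ i a) → v ∈Span w → v′ ∈Span w′
  ∈Span-resp v≈v′ w≈w′ (co , v≈) =
    co , λ a → ≈-trans (≈-sym (v≈v′ a)) (≈-trans (v≈ a) (sum-cong-≋ (λ i → *-congˡ (w≈w′ i a))))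

  ∈Span-rows : ∀ {q m n} (ρ : Fin m → Fin n) {v : Vec n} {w : Fin q → Vec n} →
               v ∈Span w → (v ∘ ρ) ∈Span (λ i → w i ∘ ρ)
  ∈Span-rows ρ (co , v≈) = co , v≈ ∘ ρ

  ∈Span-member : ∀ {q n} (w : Fin (suc q) → Vec n) i → w i ∈Span w
  ∈Span-member w i = unit i , λ a → ≈-sym (sum-unit i (λ j → w j a))

  ∈Span-trans : ∀ {k q n} {v : Vec n} {u : Fin k → Vec n} {w : Fin q → Vec n} →
                v ∈Span u → (∀ j → u j ∈Span w) → v ∈Span w
  ∈Span-trans {v = v} {u} {w} (cv , v≈) u∈ = (λ i → sum (λ j → cv j * cu j i)) , λ a → begin
    v a                                             ≈⟨ v≈ a ⟩
    sum (λ j → cv j * u j a)                        ≈⟨ sum-cong-≋ (λ j → *-congˡ (proj₂ (u∈ j) a)) ⟩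
    sum (λ j → cv j * sum (λ i → cu j i * w i a))
      ≈⟨ sum-cong-≋ (λ j → ≈-trans (*-distribˡ-sum (cv j) (λ i → cu j i * w i a))
                                   (sum-cong-≋ (λ i → ≈-sym (*-assoc (cv j) (cu j i) (w i a))))) ⟩
    sum (λ j → sum (λ i → cv j * cu j i * w i a))   ≈⟨ ∑-comm (λ j i → cv j * cu j i * w i a) ⟩
    sum (λ i → sum (λ j → cv j * cu j i * w i a))
      ≈⟨ sum-cong-≋ (λ i → ≈-sym (*-distribʳ-sum (w i a) (λ j → cv j * cu j i))) ⟩
    sum (λ i → sum (λ j → cv j * cu j i) * w i a)   ∎
    where
    cu : ∀ j → Vec _
    cu j = proj₁ (u∈ j)

  ∈Span-suc : ∀ {q n} {v : Vec n} {w : Fin (suc q) → Vec n} → v ∈Span (w ∘ suc) → v ∈Span w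
  ∈Span-suc {w = w} v∈ = ∈Span-trans {u = w ∘ suc} {w = w} v∈ (λ i → ∈Span-member w (suc i))

  ∈Span-axpy : ∀ {q n} {v u : Vec n} {w : Fin q → Vec n} → v ∈Span w → u ∈Span w → ∀ m →
               (λ a → v a + m * u a) ∈Span w
  ∈Span-axpy {w = w} (cv , v≈) (cu , u≈) m = (λ i → cv i + m * cu i) , λ a →
    ≈-trans (+-cong (v≈ a) (*-congˡ (u≈ a))) (≈-sym (linComb-axpy cv cu m w a))

  ∈Span-tail : ∀ {q n} {v : Vec n} {w : Fin (suc q) → Vec n} (v∈ : v ∈Span w) →
               proj₁ v∈ zero ≈ 0# → v ∈Span (w ∘ suc)
  ∈Span-tail {w = w} (co , v≈) co₀≈0 = co ∘ suc , λ a →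
    ≈-trans (v≈ a) (≈-trans (+-congʳ (≈-trans (*-congʳ co₀≈0) (zeroˡ (w zero a)))) (+-identityˡ _))

  independent⇒coef≈0 : ∀ {k n} {v : Fin k → Vec n} → LinearlyIndependent F v →
                        ∀ coef → (∀ a → linComb coef v a ≈ 0#) → ∀ j → coef j ≈ 0#
  independent⇒coef≈0 {v = v} li coef lc≈0 =
    li coef (λ a → ≈-trans (≈-reflexive (sumF≡sum (λ j → coef j * v j a))) (lc≈0 a))

  coef≈0⇒independent : ∀ {k n} {v : Fin k → Vec n} →
                        (∀ coef → (∀ a → linComb coef v a ≈ 0#) → ∀ j → coef j ≈ 0#) →
                        LinearlyIndependent F v
  coef≈0⇒independent {v = v} h coef lc≈0 =
    h coef (λ a → ≈-trans (≈-reflexive (≡.sym (sumF≡sum (λ j → coef j * v j a)))) (lc≈0 a))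

  independent-resp : ∀ {k n} {v v′ : Fin k → Vec n} → (∀ j a → v j a ≈ v′ j a) →
                     LinearlyIndependent F v → LinearlyIndependent F v′
  independent-resp {v = v} {v′} v≈v′ li = coef≈0⇒independent λ coef lc≈0 →
    independent⇒coef≈0 li coef (λ a → ≈-trans (sum-cong-≋ (λ j → *-congˡ (v≈v′ j a))) (lc≈0 a))

  shear-independent : ∀ {k n} (j₀ : Fin (suc k)) (m : Vec k) {v : Fin (suc k) → Vec n} →
                      LinearlyIndependent F v →
                      LinearlyIndependent F (λ l a → v (punchIn j₀ l) a + m l * v j₀ a)
  shear-independent {k} {n} j₀ m {v} li = coef≈0⇒independent λ coef′ lc≈0 l →
    ≈-trans (≈-reflexive (≡.sym (insertAt-punchIn coef′ j₀ (α coef′) l)))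
            (independent⇒coef≈0 {v = v} li (insertAt coef′ j₀ (α coef′))
                                 (λ a → ≈-trans (unshear coef′ a) (lc≈0 a)) (punchIn j₀ l))
    where
    v′ : Fin k → Vec n
    v′ l a = v (punchIn j₀ l) a + m l * v j₀ a
    α : Vec k → Carrier
    α coef′ = sum (λ l → coef′ l * m l)
    unshear : ∀ coef′ a → linComb (insertAt coef′ j₀ (α coef′)) v a ≈ linComb coef′ v′ a
    unshear coef′ a = begin
      linComb coef v a
        ≈⟨ sum-remove {i = j₀} (λ j → coef j * v j a) ⟩
      coef j₀ * v j₀ a + sum (λ l → coef (punchIn j₀ l) * v (punchIn j₀ l) a)
        ≈⟨ +-cong (*-congʳ (≈-reflexive (insertAt-same coef′ j₀ (α coef′))))
                  (sum-cong-≋ (λ l → *-congʳ (≈-reflexive (insertAt-punchIn coef′ j₀ (α coef′) l)))) ⟩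
      α coef′ * v j₀ a + sum (λ l → coef′ l * v (punchIn j₀ l) a)
        ≈⟨ +-comm _ _ ⟩
      sum (λ l → coef′ l * v (punchIn j₀ l) a) + α coef′ * v j₀ a
        ≈⟨ +-congˡ (*-distribʳ-sum (v j₀ a) (λ l → coef′ l * m l)) ⟩
      sum (λ l → coef′ l * v (punchIn j₀ l) a) + sum (λ l → coef′ l * m l * v j₀ a)
        ≈⟨ ≈-sym (∑-distrib-+ (λ l → coef′ l * v (punchIn j₀ l) a) (λ l → coef′ l * m l * v j₀ a)) ⟩
      sum (λ l → coef′ l * v (punchIn j₀ l) a + coef′ l * m l * v j₀ a)
        ≈⟨ sum-cong-≋ (λ l → solve 4 (λ x y z w → x :* y :+ x :* z :* w := x :* (y :+ z :* w))
                                     ≈-refl (coef′ l) (v (punchIn j₀ l) a) (m l) (v j₀ a)) ⟩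
      linComb coef′ v′ a ∎
      where
      coef = insertAt coef′ j₀ (α coef′)

  inverse-cancel : ∀ x b γ → b * γ ≈ 1# → x + - (x * γ) * b ≈ 0#
  inverse-cancel x b γ bγ≈1 = begin
    x + - (x * γ) * b   ≈⟨ +-congˡ (≈-sym (-‿distribˡ-* (x * γ) b)) ⟩
    x + - (x * γ * b)   ≈⟨ +-congˡ (-‿cong x*γ*b≈x) ⟩
    x + - x             ≈⟨ -‿inverseʳ x ⟩
    0#                  ∎
    where
    x*γ*b≈x : x * γ * b ≈ x
    x*γ*b≈x = ≈-trans (solve 3 (λ x γ b → x :* γ :* b := x :* (b :* γ)) ≈-refl x γ b)
                      (≈-trans (*-congˡ bγ≈1) (*-identityʳ x))

  -- If the first generator occurs in some vᵢ, it is eliminated from the others by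
  -- shearing, which keeps them independent; otherwise it can simply be dropped.
  steinitz : ∀ q {k n} → q < k → (v : Fin k → Vec n) (w : Fin q → Vec n) →
             (∀ j → v j ∈Span w) → ¬ LinearlyIndependent F v
  steinitz zero {suc k} _ v w v∈w li =
    0≉1 (≈-sym (independent⇒coef≈0 {v = v} li (λ _ → 1#) all≈0 zero))
    where
    all≈0 : ∀ a → linComb (λ _ → 1#) v a ≈ 0#
    all≈0 a = sum-zero (λ j → ≈-trans (*-identityˡ (v j a)) (proj₂ (v∈w j) a))
  steinitz (suc q) {suc k} (s≤s q<k) v w v∈w li = ¬¬-excluded-middle {A = ∃ λ j → ¬ head j ≈ 0#} λ
    { (yes (j₀ , c≉0)) → eliminate j₀ c≉0
    ; (no ∄) → ¬¬-pull-Fin (λ j c≉0 → ∄ (j , c≉0)) drop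
    }
    where
    head : Fin (suc k) → Carrier
    head j = proj₁ (v∈w j) zero

    drop : (∀ j → head j ≈ 0#) → ⊥
    drop heads≈0 =
      steinitz q (ℕₚ.m<n⇒m<1+n q<k) v (w ∘ suc) (λ j → ∈Span-tail {w = w} (v∈w j) (heads≈0 j)) li

    eliminate : ∀ j₀ → ¬ head j₀ ≈ 0# → ⊥
    eliminate j₀ c≉0 = steinitz q q<k v′ (w ∘ suc) v′∈w′ (shear-independent j₀ m {v} li)
      where
      γ = proj₁ (inverse (head j₀) c≉0)
      m : Vec k
      m l = - (head (punchIn j₀ l) * γ)
      v′ : Fin k → Vec _
      v′ l a = v (punchIn j₀ l) a + m l * v j₀ a
      v′∈w′ : ∀ l → v′ l ∈Span (w ∘ suc)
      v′∈w′ l = ∈Span-tail {w = w} (∈Span-axpy {w = w} (v∈w (punchIn j₀ l)) (v∈w j₀) (m l))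
                  (inverse-cancel (head (punchIn j₀ l)) (head j₀) γ (proj₂ (inverse (head j₀) c≉0)))

  rank-resp : ∀ {k l r} {M M′ : Matrix Carrier k l} → (∀ a j → M a j ≈ M′ a j) →
              RankAtMost F r M → RankAtMost F r M′
  rank-resp M≈M′ rk f f-inj li = rk f f-inj (independent-resp (λ j a → ≈-sym (M≈M′ a (f j))) li)

  firstColumns : ∀ {n} → (ℕ → Vec n) → ∀ t → Matrix Carrier n t
  firstColumns D t a j = D (toℕ j) a

  -- Gaussian elimination along D 0, D 1, …; the dual functionals are what makes
  -- the independence of the pivots constructive.
  module Columns {n} (D : ℕ → Vec n) where

    record Echelon (t : ℕ) : Set (c ⊔ ℓ) where
      field
        rank       : ℕ
        pivot      : Fin rank → ℕ
        pivot<     : ∀ i → pivot i < t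
        dual       : Fin rank → Vec n
        dual-same  : ∀ i → dot (dual i) (D (pivot i)) ≈ 1#
        dual-other : ∀ i j → i ≢ j → dot (dual i) (D (pivot j)) ≈ 0#
        spanned    : ∀ j → j < t → D j ∈Span (D ∘ pivot)

    open Echelon

    empty : Echelon 0
    empty = record
      { rank = 0 ; pivot = λ () ; pivot< = λ () ; dual = λ ()
      ; dual-same = λ () ; dual-other = λ () ; spanned = λ _ () }

    module _ {t} (e : Echelon t) where

      pivot-injective : Injective _≡_ _≡_ (pivot e)
      pivot-injective {i} {i′} pᵢ≡pᵢ′ with i Fin.≟ i′
      ... | yes i≡i′ = i≡i′
      ... | no  i≢i′ = contradiction 0≈1 0≉1
        where
        0≈1 : 0# ≈ 1#
        0≈1 = ≈-trans (≈-sym (dual-other e i i′ i≢i′))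
                (≈-trans (≈-reflexive (≡.cong (dot (dual e i) ∘ D) (≡.sym pᵢ≡pᵢ′))) (dual-same e i))

      pivots-independent : ∀ {k} (h : Fin k → Fin (rank e)) → Injective _≡_ _≡_ h →
                           LinearlyIndependent F (D ∘ pivot e ∘ h)
      pivots-independent h h-inj = coef≈0⇒independent λ coef lc≈0 j₀ →
        let φ = dual e (h j₀) in begin
        coef j₀                                          ≈⟨ ≈-sym (*-identityʳ _) ⟩
        coef j₀ * 1#                                     ≈⟨ *-congˡ (≈-sym (dual-same e (h j₀))) ⟩
        coef j₀ * dot φ (D (pivot e (h j₀)))
          ≈⟨ ≈-sym (sum-single (λ j → coef j * dot φ (D (pivot e (h j)))) j₀
                     (λ j j≢j₀ → ≈-trans (*-congˡ (dual-other e _ _ (j≢j₀ ∘ h-inj ∘ ≡.sym)))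
                                         (zeroʳ _))) ⟩
        sum (λ j → coef j * dot φ (D (pivot e (h j))))
          ≈⟨ ≈-sym (dot-linCombʳ φ coef (D ∘ pivot e ∘ h)) ⟩
        dot φ (linComb coef (D ∘ pivot e ∘ h))
          ≈⟨ sum-zero (λ a → ≈-trans (*-congˡ (lc≈0 a)) (zeroʳ _)) ⟩
        0# ∎

      rank≤ : ∀ {r} → RankAtMost F r (firstColumns D t) → rank e ≤ r
      rank≤ {r} rk with rank e ℕ.≤? r
      ... | yes rank≤r = rank≤r
      ... | no  rank≰r =
        contradiction (independent-resp columns≈ (pivots-independent h h-inj)) (rk f f-inj)
        where
        h : Fin (suc r) → Fin (rank e)
        h j = inject≤ j (ℕₚ.≰⇒> rank≰r)
        h-inj : Injective _≡_ _≡_ h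
        h-inj = Finₚ.inject≤-injective _ _ _ _
        f : Fin (suc r) → Fin t
        f j = fromℕ< (pivot< e (h j))
        f-inj : Injective _≡_ _≡_ f
        f-inj fᵢ≡fⱼ = h-inj (pivot-injective
          (≡.trans (≡.sym (Finₚ.toℕ-fromℕ< _)) (≡.trans (≡.cong toℕ fᵢ≡fⱼ) (Finₚ.toℕ-fromℕ< _))))
        columns≈ : ∀ j a → D (pivot e (h j)) a ≈ firstColumns D t a (f j)
        columns≈ j a = ≈-reflexive (≡.cong (λ i → D i a) (≡.sym (Finₚ.toℕ-fromℕ< _)))

      coordinates : Vec n → Vec (rank e)
      coordinates v i = dot (dual e i) v

      projection : Vec n → Vec n
      projection v = linComb (coordinates v) (D ∘ pivot e)

      addColumn : D t ∈Span (D ∘ pivot e) → Echelon (suc t)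
      addColumn Dₜ∈ = record
        { rank = rank e ; pivot = pivot e ; pivot< = ℕₚ.m<n⇒m<1+n ∘ pivot< e
        ; dual = dual e ; dual-same = dual-same e ; dual-other = dual-other e
        ; spanned = λ j j<1+t → [ spanned e j , (λ { ≡.refl → Dₜ∈ }) ] (ℕₚ.m<1+n⇒m<n∨m≡n j<1+t)
        }

      Separator : Set (c ⊔ ℓ)
      Separator = ∃ λ ψ → dot ψ (D t) ≈ 1# × ∀ j → dot ψ (D (pivot e j)) ≈ 0#

      -- For a coordinate a where D t differs from its projection, the functional
      -- β (eₐ - Σᵢ (D (pivot i) a) dualᵢ) with β = (D t a - projection (D t) a)⁻¹ separates.
      separator : ∀ a β → (D t a + - projection (D t) a) * β ≈ 1# → Separator
      separator a β β-inv = ψ , ψ-new , ψ-old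
        where
        κ : Vec (rank e)
        κ i = D (pivot e i) a
        ρ ψ : Vec n
        ρ b = unit a b + - 1# * linComb κ (dual e) b
        ψ b = β * ρ b

        dot-ψ : ∀ v → dot ψ v ≈ β * (v a + - sum (λ i → κ i * dot (dual e i) v))
        dot-ψ v = begin
          dot ψ v
            ≈⟨ ≈-trans (sum-cong-≋ (λ b → *-assoc β (ρ b) (v b)))
                       (≈-sym (*-distribˡ-sum β (λ b → ρ b * v b))) ⟩
          β * dot ρ v
            ≈⟨ *-congˡ (dot-axpyˡ (unit a) (linComb κ (dual e)) v (- 1#)) ⟩
          β * (dot (unit a) v + - 1# * dot (linComb κ (dual e)) v)
            ≈⟨ *-congˡ (+-cong (sum-unit a v)
                               (≈-trans (-1*x≈-x _) (-‿cong (dot-linCombˡ κ (dual e) v)))) ⟩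
          β * (v a + - sum (λ i → κ i * dot (dual e i) v)) ∎

        κ-recovered : ∀ j → sum (λ i → κ i * dot (dual e i) (D (pivot e j))) ≈ κ j
        κ-recovered j =
          ≈-trans (sum-single _ j (λ i i≢j → ≈-trans (*-congˡ (dual-other e i j i≢j)) (zeroʳ _)))
                  (≈-trans (*-congˡ (dual-same e j)) (*-identityʳ _))

        ψ-old : ∀ j → dot ψ (D (pivot e j)) ≈ 0#
        ψ-old j = begin
          dot ψ (D (pivot e j))
            ≈⟨ dot-ψ _ ⟩
          β * (κ j + - sum (λ i → κ i * dot (dual e i) (D (pivot e j))))
            ≈⟨ *-congˡ (+-congˡ (-‿cong (κ-recovered j))) ⟩
          β * (κ j + - κ j)
            ≈⟨ *-congˡ (-‿inverseʳ _) ⟩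
          β * 0#
            ≈⟨ zeroʳ β ⟩
          0# ∎

        ψ-new : dot ψ (D t) ≈ 1#
        ψ-new = begin
          dot ψ (D t)                                ≈⟨ dot-ψ _ ⟩
          β * (D t a + - sum (λ i → κ i * coordinates (D t) i))
            ≈⟨ *-congˡ (+-congˡ (-‿cong (sum-cong-≋ (λ i → *-comm (κ i) (coordinates (D t) i))))) ⟩
          β * (D t a + - projection (D t) a)         ≈⟨ *-comm _ _ ⟩
          (D t a + - projection (D t) a) * β         ≈⟨ β-inv ⟩
          1#                                         ∎

      classify : ¬ ¬ (D t ∈Span (D ∘ pivot e) ⊎ Separator)
      classify k = ¬¬-excluded-middle {A = ∃ λ a → ¬ D t a ≈ projection (D t) a} λ
        { (yes (a , Dₜ≉p)) → k (inj₂ (separate a (inverse _ (Dₜ≉p ∘ x∙y⁻¹≈ε⇒x≈y _ _))))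
        ; (no ∄) → ¬¬-pull-Fin (λ a Dₜ≉p → ∄ (a , Dₜ≉p)) (λ Dₜ≈p → k (inj₁ (coordinates (D t) , Dₜ≈p)))
        }
        where
        separate : ∀ a → ∃ (λ β → (D t a + - projection (D t) a) * β ≈ 1#) → Separator
        separate a (β , β-inv) = separator a β β-inv

      addPivot : Separator → Echelon (suc t)
      addPivot (ψ , ψ-new , ψ-old) = record
        { rank = suc (rank e) ; pivot = pivot′ ; pivot< = pivot′< ; dual = dual′
        ; dual-same = dual′-same ; dual-other = dual′-other ; spanned = spanned′ }
        where
        pivot′ : Fin (suc (rank e)) → ℕ
        pivot′ zero    = t
        pivot′ (suc i) = pivot e i

        pivot′< : ∀ i → pivot′ i < suc t
        pivot′< zero    = ℕₚ.n<1+n t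
        pivot′< (suc i) = ℕₚ.m<n⇒m<1+n (pivot< e i)

        dual′ : Fin (suc (rank e)) → Vec n
        dual′ zero      = ψ
        dual′ (suc i) b = dual e i b + - coordinates (D t) i * ψ b

        dot-dual′ : ∀ i v → dot (dual′ (suc i)) v ≈ dot (dual e i) v + - coordinates (D t) i * dot ψ v
        dot-dual′ i v = dot-axpyˡ (dual e i) ψ v (- coordinates (D t) i)

        unchanged : ∀ i j → dot (dual′ (suc i)) (D (pivot e j)) ≈ dot (dual e i) (D (pivot e j))
        unchanged i j = ≈-trans (dot-dual′ i _)
          (≈-trans (+-congˡ (≈-trans (*-congˡ (ψ-old j)) (zeroʳ _))) (+-identityʳ _))

        dual′-same : ∀ i → dot (dual′ i) (D (pivot′ i)) ≈ 1#
        dual′-same zero    = ψ-new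
        dual′-same (suc i) = ≈-trans (unchanged i i) (dual-same e i)

        dual′-other : ∀ i j → i ≢ j → dot (dual′ i) (D (pivot′ j)) ≈ 0#
        dual′-other zero    zero    i≢j = contradiction ≡.refl i≢j
        dual′-other zero    (suc j) _   = ψ-old j
        dual′-other (suc i) zero    _   = begin
          dot (dual′ (suc i)) (D t)                                  ≈⟨ dot-dual′ i _ ⟩
          coordinates (D t) i + - coordinates (D t) i * dot ψ (D t)
            ≈⟨ +-congˡ (≈-trans (*-congˡ ψ-new) (*-identityʳ _)) ⟩
          coordinates (D t) i + - coordinates (D t) i                ≈⟨ -‿inverseʳ _ ⟩
          0#                                                         ∎
        dual′-other (suc i) (suc j) i≢j = ≈-trans (unchanged i j) (dual-other e i j (i≢j ∘ ≡.cong suc))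

        spanned′ : ∀ j → j < suc t → D j ∈Span (D ∘ pivot′)
        spanned′ j j<1+t =
          [ (λ j<t → ∈Span-suc {w = D ∘ pivot′} (spanned e j j<t))
          , (λ { ≡.refl → ∈Span-member (D ∘ pivot′) zero })
          ] (ℕₚ.m<1+n⇒m<n∨m≡n j<1+t)

    echelon : ∀ t → ¬ ¬ Echelon t
    echelon zero    = pure empty
    echelon (suc t) = echelon t >>= λ e → [ addColumn e , addPivot e ] <$> classify e

  open Columns using (Echelon; empty; echelon; addColumn; addPivot; classify; rank≤)
  open Echelon

  transpose : ∀ {k l} → Matrix Carrier k l → Matrix Carrier l k
  transpose M b a = M a b

  -- Every column of M is a combination of the pivot columns, so every row of M is a
  -- combination of the rank M coefficient vectors.
  rank-transpose : ∀ {k l r} (M : Matrix Carrier k l) →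
                   RankAtMost F r M → RankAtMost F r (transpose M)
  rank-transpose {k} {l} {r} M rk f f-inj li = echelon D l λ e →
    steinitz (rank e) (s≤s (rank≤ D e (rank-resp column≈ rk))) _ (coefficients e) (rows∈ e) li
    where
    D : ℕ → Vec k
    D j a = extend 0# (M a) j
    column≈ : ∀ a j → M a j ≈ firstColumns D l a j
    column≈ a j = ≈-reflexive (≡.sym (extend-toℕ 0# (M a) j))
    coefficients : (e : Echelon D l) → Fin (rank e) → Vec l
    coefficients e i b = proj₁ (spanned e (toℕ b) (Finₚ.toℕ<n b)) i
    rows∈ : ∀ e j → (λ b → M (f j) b) ∈Span coefficients e
    rows∈ e j = (λ i → D (pivot e i) (f j)) , λ b →
      ≈-trans (column≈ (f j) b)
        (≈-trans (proj₂ (spanned e (toℕ b) (Finₚ.toℕ<n b)) (f j))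
                 (sum-cong-≋ (λ i → *-comm (coefficients e i b) (D (pivot e i) (f j)))))

  module HankelMatrices (y : ℕ → Carrier) where

    hankelColumn : ∀ p → ℕ → Vec (suc p)
    hankelColumn p j a = y (toℕ a ℕ.+ j)

    Hankel : ∀ p t → Matrix Carrier (suc p) (suc t)
    Hankel p t = firstColumns (hankelColumn p) (suc t)

    Hankel-cast : ∀ {r p p′ t t′} → p ≡ p′ → t ≡ t′ →
                  RankAtMost F r (Hankel p t) ⇔ RankAtMost F r (Hankel p′ t′)
    Hankel-cast ≡.refl ≡.refl = ⇔-refl

    rank-Hankel-transpose : ∀ {r p t} → RankAtMost F r (Hankel p t) → RankAtMost F r (Hankel t p)
    rank-Hankel-transpose {p = p} {t} =
      rank-resp (λ a b → ≈-reflexive (≡.cong y (ℕₚ.+-comm (toℕ b) (toℕ a))))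
      ∘ rank-transpose (Hankel p t)

    module Shift (p : ℕ) where
      D A : ℕ → Vec _
      D = hankelColumn (suc p)
      A = hankelColumn p

      restrict : ∀ {q j} {u : Fin q → ℕ} → D j ∈Span (D ∘ u) → A j ∈Span (A ∘ u)
      restrict {j = j} {u} = ∈Span-resp (top j) (λ i → top (u i)) ∘ ∈Span-rows inject₁
        where
        top : ∀ j a → D j (inject₁ a) ≈ A j a
        top j a = ≈-reflexive (≡.cong (λ i → y (i ℕ.+ j)) (Finₚ.toℕ-inject₁ a))

      shift : ∀ {q j} {u : Fin q → ℕ} → D j ∈Span (D ∘ u) → A (suc j) ∈Span (A ∘ suc ∘ u)
      shift {j = j} {u} = ∈Span-resp (bottom j) (λ i → bottom (u i)) ∘ ∈Span-rows suc
        where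
        bottom : ∀ j a → D j (suc a) ≈ A (suc j) a
        bottom j a = ≈-reflexive (≡.cong y (≡.sym (ℕₚ.+-suc (toℕ a) j)))

      SpannedUpTo : ℕ → ℕ → Set (c ⊔ ℓ)
      SpannedUpTo q t = ∃ λ (w : Fin q → Vec (suc p)) → ∀ j → j ≤ t → A j ∈Span w

      Deficient : ℕ → Set (c ⊔ ℓ)
      Deficient t = Σ (Echelon D t) λ e → rank e < t → SpannedUpTo (rank e) t

      -- A dependency D t = Σ cᵢ D (pivot i) gives both A t and A (t + 1) as
      -- combinations of the columns A (pivot i) and A (pivot i + 1).
      afterColumn : ∀ {t} (e : Echelon D t) → D t ∈Span (D ∘ pivot e) → SpannedUpTo (rank e) (suc t)
      afterColumn {t} e Dₜ∈ = A ∘ pivot e , λ j j≤1+t →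
        [ (λ j<1+t → restrict (spanned e′ j j<1+t))
        , (λ { ≡.refl → ∈Span-trans (shift Dₜ∈) (λ i → restrict (spanned e′ _ (s≤s (pivot< e i)))) })
        ] (ℕₚ.m≤n⇒m<n∨m≡n j≤1+t)
        where
        e′ = addColumn D e Dₜ∈

      afterPivot : ∀ {t} (e : Echelon D t) → (rank e < t → SpannedUpTo (rank e) t) →
                   suc (rank e) < suc t → SpannedUpTo (suc (rank e)) (suc t)
      afterPivot {t} e spanned-before (s≤s rank<t) = w′ , λ j j≤1+t →
        [ (λ j<1+t → ∈Span-suc {w = w′} (A∈w j (ℕₚ.≤-pred j<1+t)))
        , (λ { ≡.refl → ∈Span-member w′ zero })
        ] (ℕₚ.m≤n⇒m<n∨m≡n j≤1+t)
        where
        w = proj₁ (spanned-before rank<t)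
        A∈w = proj₂ (spanned-before rank<t)
        w′ : Fin (suc (rank e)) → Vec (suc p)
        w′ zero    = A (suc t)
        w′ (suc i) = w i

      deficient : ∀ t → ¬ ¬ Deficient t
      deficient zero    = pure (empty D , λ ())
      deficient (suc t) = deficient t >>= λ (e , before) →
        [ (λ Dₜ∈ → addColumn D e Dₜ∈ , λ _ → afterColumn e Dₜ∈)
        , (λ new → addPivot D e new , afterPivot e before)
        ] <$> classify D e

    rank-shift : ∀ {r p t} → r ≤ t →
                 RankAtMost F r (Hankel (suc p) t) → RankAtMost F r (Hankel p (suc t))
    rank-shift {r} {p} {t} r≤t rk f f-inj li = deficient (suc t) λ (e , spanned-if) →
      let rank≤r = rank≤ D e rk
          (w , A∈w) = spanned-if (s≤s (ℕₚ.≤-trans rank≤r r≤t))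
      in steinitz (rank e) (s≤s rank≤r) _ w (λ j → A∈w (toℕ (f j)) (ℕₚ.≤-pred (Finₚ.toℕ<n (f j)))) li
      where
      open Shift p

    rank-unshift : ∀ {r p t} → r ≤ p →
                   RankAtMost F r (Hankel p (suc t)) → RankAtMost F r (Hankel (suc p) t)
    rank-unshift r≤p = rank-Hankel-transpose ∘ rank-shift r≤p ∘ rank-Hankel-transpose

    rank-slide : ∀ {r} k {n} → r ≤ n →
                 RankAtMost F r (Hankel (r ℕ.+ k) n) ⇔ RankAtMost F r (Hankel r (k ℕ.+ n))
    rank-slide {r} zero    r≤n = Hankel-cast (ℕₚ.+-identityʳ r) ≡.refl
    rank-slide {r} (suc k) {n} r≤n =
      ⇔-trans (Hankel-cast (ℕₚ.+-suc r k) ≡.refl)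
        (⇔-trans (mk⇔ (rank-shift r≤n) (rank-unshift (ℕₚ.m≤m+n r k)))
          (⇔-trans (rank-slide k (ℕₚ.m≤n⇒m≤1+n r≤n)) (Hankel-cast ≡.refl (ℕₚ.+-suc k n))))

  H⇔Hankel : ∀ {u p t r} (pt≤u : p ℕ.+ t ≤ u) (x : Fin (suc u) → Carrier) →
             RankAtMost F r (H p t pt≤u x) ⇔ RankAtMost F r (HankelMatrices.Hankel (extend 0# x) p t)
  H⇔Hankel pt≤u x = mk⇔ (rank-resp H≈Hankel) (rank-resp (λ a j → ≈-sym (H≈Hankel a j)))
    where
    H≈Hankel : ∀ a j → H _ _ pt≤u x a j ≈ HankelMatrices.Hankel (extend 0# x) _ _ a j
    H≈Hankel a j = ≈-reflexive (≡.sym (extend-fromℕ< 0# x (hankel-bound pt≤u a j)))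

open import Data.Nat using (_+_; _∸_)

lemma2p6 : ∀ {c ℓ : Level} (F : Field c ℓ) (u m n r : ℕ) →
    (mn≤u : m + n ≤ u) → (r≤m : r ≤ m) → r ≤ n →
    (x : Fin (suc u) → Field.Carrier F) →
    RankAtMost F r (H m n mn≤u x) ⇔ RankAtMost F r (H r (m + n ∸ r) (rs-bound mn≤u r≤m) x)
lemma2p6 {c} {ℓ} F u m n r mn≤u r≤m r≤n x = begin
  RankAtMost F r (H m n mn≤u x)                   ≈⟨ H⇔Hankel mn≤u x ⟩
  RankAtMost F r (Hankel m n)                     ≈⟨ Hankel-cast (≡.sym (ℕₚ.m+[n∸m]≡n r≤m)) ≡.refl ⟩
  RankAtMost F r (Hankel (r + (m ∸ r)) n)         ≈⟨ rank-slide (m ∸ r) r≤n ⟩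
  RankAtMost F r (Hankel r (m ∸ r + n))           ≈⟨ Hankel-cast ≡.refl (≡.sym (ℕₚ.+-∸-comm n r≤m)) ⟩
  RankAtMost F r (Hankel r (m + n ∸ r))           ≈⟨ ⇔-sym (H⇔Hankel (rs-bound mn≤u r≤m) x) ⟩
  RankAtMost F r (H r (m + n ∸ r) (rs-bound mn≤u r≤m) x) ∎
  where
  open LinearAlgebra F using (H⇔Hankel; module HankelMatrices)
  open HankelMatrices (extend (Field.0# F) x) using (Hankel; Hankel-cast; rank-slide)
  open import Relation.Binary.Reasoning.Setoid (⇔-setoid (c ⊔ ℓ))
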